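{- Let $G$ be a finite, simple, connected graph which is randomly $k$-dimensional with $k\geq 2$. Then $G$ has no cut vertex.
   Context: $d(x,y)$ is the distance in $G$. For an ordered set $W=\{w_1,\ldots,w_k\}\subseteq V(G)$ and $v\in V(G)$, $r(v|W)=(d(v,w_1),\ldots,d(v,w_k))$. $W$ is a resolving set if distinct vertices have distinct representations with respect to $W$. The metric dimension $\beta(G)$ is the minimum size of a resolving set; a resolving set of size $\beta(G)$ is a basis. $G$ is randomly $k$-dimensional if $\beta(G)=k$ and every $k$-subset of $V(G)$ is a basis of $G$. A cut vertex is a vertex $v$ such that $G\setminus\{v\}$ has at least two connected components. -}

module Defs where

open import Data.Nat using (ℕ; zero; suc; _≤_; _<_)
open import Data.Fin using (Fin)
open import Data.Fin.Subset using (Subset; _∈_; ∣_∣)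
open import Data.Bool using (Bool; T)
open import Data.Unit using (⊤)
open import Data.Product using (_×_; ∃; Σ)
open import Relation.Nullary using (¬_)
open import Relation.Binary.PropositionalEquality using (_≡_; _≢_)

record Graph (n : ℕ) : Set where
  field
    adj     : Fin n → Fin n → Bool
    adj-sym : ∀ x y → T (adj x y) → T (adj y x)
    irrefl  : ∀ x → ¬ T (adj x x)

module _ {n : ℕ} (G : Graph n) where
  open Graph G

  Adj : Fin n → Fin n → Set
  Adj x y = T (adj x y)

  data WalkIn (P : Fin n → Set) : Fin n → Fin n → ℕ → Set where
    here : ∀ {x} → P x → WalkIn P x x zero
    step : ∀ {x z y ℓ} → P x → Adj x z → WalkIn P z y ℓ → WalkIn P x y (suc ℓ)

  Walk : Fin n → Fin n → ℕ → Set
  Walk = WalkIn (λ _ → ⊤)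

  Connected : Set
  Connected = ∀ x y → ∃ λ ℓ → Walk x y ℓ

  Dist : Fin n → Fin n → ℕ → Set
  Dist x y m = Walk x y m × (∀ ℓ → Walk x y ℓ → m ≤ ℓ)

  SameRep : Subset n → Fin n → Fin n → Set
  SameRep W u v = ∀ w → w ∈ W → ∀ m → (Dist u w m → Dist v w m) × (Dist v w m → Dist u w m)

  Resolving : Subset n → Set
  Resolving W = ∀ u v → SameRep W u v → u ≡ v

  MetricDimension : ℕ → Set
  MetricDimension k = (∃ λ W → ∣ W ∣ ≡ k × Resolving W)
                    × (∀ W → Resolving W → k ≤ ∣ W ∣)

  RandomlyDimensional : ℕ → Set
  RandomlyDimensional k = MetricDimension k × (∀ W → ∣ W ∣ ≡ k → Resolving W)

  CutVertex : Fin n → Set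
  CutVertex v = Σ (Fin n) λ x → Σ (Fin n) λ y →
    x ≢ v × y ≢ v × (∀ ℓ → ¬ WalkIn (λ z → z ≢ v) x y ℓ)

-- Let the cut vertex v separate x from y. Every vertex p is off x's side or off y's side
-- of v, and for a vertex w on the other side d(p,w) = d(p,v) + d(v,w); hence
-- d(p,v) = max (d(p,x) − d(v,x)) (d(p,y) − d(v,y)), i.e. the coordinate of v is redundant
-- in any representation that contains x and y.
-- For k ≥ 3, a k-set containing v, x, y is a basis, so removing v leaves a resolving set of
-- size k − 1 < β. For k = 2, every pair {v, z} is a basis, so vertices off z's side are
-- determined by their distance to v. Let e be a vertex off y's side farthest from v. Then
-- vertices p off y's side lie on a geodesic from v to e, d(p,e) = d(v,e) − d(v,p), while
-- vertices on y's side have d(p,e) = d(p,v) + d(v,e) > d(v,e); so {e} resolves G,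
-- contradicting β = 2.
module Submission where

open import Defs
open import Data.Nat using (ℕ; zero; suc; _+_; _∸_; _⊔_; _≤_; _<_; z≤n; s≤s; _<?_)
open import Data.Nat.Properties hiding (_≟_)
open import Data.Fin using (Fin; zero; suc; _≟_)
open import Data.Fin.Properties using (any?)
open import Data.Fin.Subset using (Subset; inside; outside; _∈_; _⊆_; ⁅_⁆; _∪_; _-_; ∣_∣)
open import Data.Fin.Subset.Properties
  using (∣p∣≤n; ∣p∣≤∣x∷p∣; ∣⁅x⁆∣≡1; x∈⁅x⁆; x∈⁅y⁆⇒x≡y; x∈p∪q⁺; x∈p∪q⁻; x∈p∧x≢y⇒x∈p-y; x∈p⇒∣p-x∣<∣p∣)
open import Data.Vec using (_∷_; []; here; there)
open import Data.List using (List; filter; upTo; allFin)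
open import Data.List.Extrema.Nat
  using (argmin; argmax; argmin-all; argmax-all; f[argmin]≤f[⊤]; f[argmin]≤f[xs]; f[xs]≤f[argmax])
open import Data.List.Relation.Unary.All using (lookup)
open import Data.List.Relation.Unary.All.Properties using (all-filter)
open import Data.List.Membership.Propositional.Properties using (∈-filter⁺; ∈-upTo⁺; ∈-allFin)
open import Data.Unit using (tt)
open import Data.Product using (_×_; ∃; ∃₂; _,_; proj₁; proj₂)
open import Data.Sum using (_⊎_; inj₁; inj₂; [_,_]′)
open import Data.Empty using (⊥)
open import Function using (_∘_; id)
open import Relation.Nullary using (¬_; Dec; yes; no; contradiction)
open import Relation.Nullary.Decidable using (T?; ¬?; map′; _×-dec_; ¬¬-excluded-middle)
open import Relation.Unary using (Decidable)
open import Relation.Binary.PropositionalEquality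

-- Opaque, so that typechecking never unfolds the list searches behind d and the farthest vertex.
opaque
  least : ∀ {P : ℕ → Set} → Decidable P → ∀ {ℓ} → P ℓ → ∃ λ m → P m × (∀ k → P k → m ≤ k)
  least {P} P? {ℓ} Pℓ = m , argmin-all id Pℓ (all-filter P? (upTo ℓ)) , minimal
    where
    xs : List ℕ
    xs = filter P? (upTo ℓ)
    m : ℕ
    m = argmin id ℓ xs
    minimal : ∀ k → P k → m ≤ k
    minimal k Pk with k <? ℓ
    ... | yes k<ℓ = lookup (f[argmin]≤f[xs] {f = id} ℓ xs) (∈-filter⁺ P? (∈-upTo⁺ k<ℓ) Pk)
    ... | no k≮ℓ = ≤-trans (f[argmin]≤f[⊤] {f = id} ℓ xs) (≮⇒≥ k≮ℓ)

  maximise : ∀ {m} {P : Fin m → Set} → Decidable P → (f : Fin m → ℕ) →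
             ∀ {i} → P i → ∃ λ e → P e × (∀ j → P j → f j ≤ f e)
  maximise {m} {P} P? f {i} Pi = e , argmax-all f Pi (all-filter P? (allFin m)) , maximal
    where
    xs : List (Fin m)
    xs = filter P? (allFin m)
    e : Fin m
    e = argmax f i xs
    maximal : ∀ j → P j → f j ≤ f e
    maximal j Pj = lookup (f[xs]≤f[argmax] i xs) (∈-filter⁺ P? (∈-allFin j) Pj)

¬¬-∀-Fin : ∀ {m} {Q : Fin m → Set} → (∀ i → ¬ ¬ Q i) → ¬ ¬ (∀ i → Q i)
¬¬-∀-Fin {zero}  _   ¬∀ = ¬∀ λ ()
¬¬-∀-Fin {suc m} ¬¬Q ¬∀ = ¬¬Q zero λ Q₀ →
  ¬¬-∀-Fin (¬¬Q ∘ suc) λ Qs → ¬∀ λ { zero → Q₀ ; (suc i) → Qs i }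

∣p∪q∣≤∣p∣+∣q∣ : ∀ {m} (p q : Subset m) → ∣ p ∪ q ∣ ≤ ∣ p ∣ + ∣ q ∣
∣p∪q∣≤∣p∣+∣q∣ []            []            = z≤n
∣p∪q∣≤∣p∣+∣q∣ (inside  ∷ p) (b       ∷ q) =
  s≤s (≤-trans (∣p∪q∣≤∣p∣+∣q∣ p q) (+-monoʳ-≤ ∣ p ∣ (∣p∣≤∣x∷p∣ b q)))
∣p∪q∣≤∣p∣+∣q∣ (outside ∷ p) (inside  ∷ q) =
  ≤-trans (s≤s (∣p∪q∣≤∣p∣+∣q∣ p q)) (≤-reflexive (sym (+-suc ∣ p ∣ ∣ q ∣)))
∣p∪q∣≤∣p∣+∣q∣ (outside ∷ p) (outside ∷ q) = ∣p∪q∣≤∣p∣+∣q∣ p q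

∣⁅x⁆∪p∣≤1+∣p∣ : ∀ {m} (x : Fin m) p → ∣ ⁅ x ⁆ ∪ p ∣ ≤ suc ∣ p ∣
∣⁅x⁆∪p∣≤1+∣p∣ x p = subst (λ c → ∣ ⁅ x ⁆ ∪ p ∣ ≤ c + ∣ p ∣) (∣⁅x⁆∣≡1 x) (∣p∪q∣≤∣p∣+∣q∣ ⁅ x ⁆ p)

∣⁅x⁆∪⁅y⁆∣≡2 : ∀ {m} {x y : Fin m} → x ≢ y → ∣ ⁅ x ⁆ ∪ ⁅ y ⁆ ∣ ≡ 2
∣⁅x⁆∪⁅y⁆∣≡2 {x = x} {y} x≢y = ≤-antisym
  (subst (λ c → ∣ ⁅ x ⁆ ∪ ⁅ y ⁆ ∣ ≤ suc c) (∣⁅x⁆∣≡1 y) (∣⁅x⁆∪p∣≤1+∣p∣ x ⁅ y ⁆))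
  (≤-trans (s≤s (≤-trans (s≤s z≤n) (x∈p⇒∣p-x∣<∣p∣ y∈p-x))) (x∈p⇒∣p-x∣<∣p∣ x∈p))
  where
  x∈p : x ∈ ⁅ x ⁆ ∪ ⁅ y ⁆
  x∈p = x∈p∪q⁺ (inj₁ (x∈⁅x⁆ x))
  y∈p-x : y ∈ (⁅ x ⁆ ∪ ⁅ y ⁆) - x
  y∈p-x = x∈p∧x≢y⇒x∈p-y (x∈p∪q⁺ (inj₂ (x∈⁅x⁆ y))) (x≢y ∘ sym)

∃-superset : ∀ {m} (p : Subset m) k → ∣ p ∣ ≤ k → k ≤ m → ∃ λ r → p ⊆ r × ∣ r ∣ ≡ k
∃-superset []            zero    _         _         = [] , id , refl
∃-superset (inside  ∷ p) (suc k) (s≤s p≤k) (s≤s k≤m) with ∃-superset p k p≤k k≤m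
... | r , p⊆r , ∣r∣≡k = inside ∷ r , (λ { here → here ; (there i) → there (p⊆r i) }) , cong suc ∣r∣≡k
∃-superset {suc m} (outside ∷ p) k p≤k k≤1+m with m≤n⇒m<n∨m≡n k≤1+m
... | inj₁ (s≤s k≤m) with ∃-superset p k p≤k k≤m
...   | r , p⊆r , ∣r∣≡k = outside ∷ r , (λ { (there i) → there (p⊆r i) }) , ∣r∣≡k
∃-superset {suc m} (outside ∷ p) k p≤k k≤1+m | inj₂ refl with ∃-superset p m (∣p∣≤n p) ≤-refl
...   | r , p⊆r , ∣r∣≡m = inside ∷ r , (λ { (there i) → there (p⊆r i) }) , cong suc ∣r∣≡m

∃-superset-of-three : ∀ {m k} (a b c : Fin m) → 3 ≤ k → k ≤ m →
                      ∃ λ W → a ∈ W × b ∈ W × c ∈ W × ∣ W ∣ ≡ k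
∃-superset-of-three {k = k} a b c 3≤k k≤m with ∃-superset (⁅ a ⁆ ∪ (⁅ b ⁆ ∪ ⁅ c ⁆)) k ∣abc∣≤k k≤m
  where
  ∣abc∣≤k : ∣ ⁅ a ⁆ ∪ (⁅ b ⁆ ∪ ⁅ c ⁆) ∣ ≤ k
  ∣abc∣≤k = ≤-trans (∣⁅x⁆∪p∣≤1+∣p∣ a _)
              (≤-trans (s≤s (∣⁅x⁆∪p∣≤1+∣p∣ b _)) (subst (λ n → 2 + n ≤ k) (sym (∣⁅x⁆∣≡1 c)) 3≤k))
... | W , abc⊆W , ∣W∣≡k =
  W , abc⊆W (x∈p∪q⁺ (inj₁ (x∈⁅x⁆ a)))
    , abc⊆W (x∈p∪q⁺ (inj₂ (x∈p∪q⁺ (inj₁ (x∈⁅x⁆ b)))))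
    , abc⊆W (x∈p∪q⁺ (inj₂ (x∈p∪q⁺ (inj₂ (x∈⁅x⁆ c)))))
    , ∣W∣≡k

module Walks {n : ℕ} (G : Graph n) where
  open Graph G

  source : ∀ {P x y ℓ} → WalkIn G P x y ℓ → P x
  source (here Px)     = Px
  source (step Px _ _) = Px

  _++_ : ∀ {P x y z a b} → WalkIn G P x y a → WalkIn G P y z b → WalkIn G P x z (a + b)
  here _       ++ w′ = w′
  step Px e w ++ w′ = step Px e (w ++ w′)

  snoc : ∀ {P x y z ℓ} → WalkIn G P x y ℓ → Adj G y z → P z → WalkIn G P x z (suc ℓ)
  snoc (here Px)     e Pz = step Px e (here Pz)
  snoc (step Px e w) f Pz = step Px e (snoc w f Pz)

  reverse : ∀ {P x y ℓ} → WalkIn G P x y ℓ → WalkIn G P y x ℓ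
  reverse (here Px)                = here Px
  reverse (step {x = x} Px e w) = snoc (reverse w) (adj-sym x _ e) Px

  walk? : ∀ x y ℓ → Dec (Walk G x y ℓ)
  walk? x y zero = map′ (λ { refl → here tt }) (λ { (here _) → refl }) (x ≟ y)
  walk? x y (suc ℓ) = map′ (λ { (_ , e , w) → step tt e w }) (λ { (step _ e w) → _ , e , w })
                           (any? λ z → T? (adj x z) ×-dec walk? z y ℓ)

  splitAt : ∀ {x z ℓ} t → t ≤ ℓ → Walk G x z ℓ → ∃ λ u → Walk G x u t × Walk G u z (ℓ ∸ t)
  splitAt zero    _         w            = _ , here tt , w
  splitAt (suc t) (s≤s t≤ℓ) (step _ e w) with splitAt t t≤ℓ w
  ... | u , w₁ , w₂ = u , step tt e w₁ , w₂

  avoids-or-visits : ∀ v {x y ℓ} → Walk G x y ℓ →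
                     WalkIn G (_≢ v) x y ℓ ⊎ ∃₂ λ a b → Walk G x v a × Walk G v y b × a + b ≡ ℓ
  avoids-or-visits v {x} (here _) with x ≟ v
  ... | yes refl = inj₂ (0 , 0 , here tt , here tt , refl)
  ... | no x≢v   = inj₁ (here x≢v)
  avoids-or-visits v {x} (step {ℓ = ℓ} _ e w) with x ≟ v
  ... | yes refl = inj₂ (0 , suc ℓ , here tt , step tt e w , refl)
  ... | no x≢v with avoids-or-visits v w
  ...   | inj₁ w′                     = inj₁ (step x≢v e w′)
  ...   | inj₂ (a , b , w₁ , w₂ , eq) = inj₂ (suc a , b , step tt e w₁ , w₂ , cong suc eq)

module Distance {n : ℕ} {G : Graph n} (connected : Connected G) where
  open Walks G

  private
    shortest : ∀ x y → ∃ λ m → Walk G x y m × (∀ ℓ → Walk G x y ℓ → m ≤ ℓ)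
    shortest x y = least (walk? x y) (proj₂ (connected x y))

  d : Fin n → Fin n → ℕ
  d x y = proj₁ (shortest x y)

  d-walk : ∀ x y → Walk G x y (d x y)
  d-walk x y = proj₁ (proj₂ (shortest x y))

  d-minimal : ∀ {x y ℓ} → Walk G x y ℓ → d x y ≤ ℓ
  d-minimal {x} {y} w = proj₂ (proj₂ (shortest x y)) _ w

  Dist⇒≡d : ∀ {x y m} → Dist G x y m → m ≡ d x y
  Dist⇒≡d {x} {y} (w , minimal) = ≤-antisym (minimal _ (d-walk x y)) (d-minimal w)

  d-Dist : ∀ x y → Dist G x y (d x y)
  d-Dist x y = d-walk x y , λ _ → d-minimal

  d-triangle : ∀ x y z → d x z ≤ d x y + d y z
  d-triangle x y z = d-minimal (d-walk x y ++ d-walk y z)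

  d-sym : ∀ x y → d x y ≡ d y x
  d-sym x y = ≤-antisym (d-minimal (reverse (d-walk y x))) (d-minimal (reverse (d-walk x y)))

  d-refl : ∀ x → d x x ≡ 0
  d-refl x = n≤0⇒n≡0 (d-minimal {x} (here tt))

  d≡0⇒≡ : ∀ {x y} → d x y ≡ 0 → x ≡ y
  d≡0⇒≡ {x} {y} d≡0 with d x y | d-walk x y
  d≡0⇒≡ refl | _ | here _ = refl

  ≢⇒0<d : ∀ {x y} → x ≢ y → 0 < d x y
  ≢⇒0<d x≢y = n≢0⇒n>0 (x≢y ∘ d≡0⇒≡)

  geodesic-split : ∀ a b t → t ≤ d a b → ∃ λ u → d a u ≡ t × d u b ≡ d a b ∸ t
  geodesic-split a b t t≤D with splitAt t t≤D (d-walk a b)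
  ... | u , w₁ , w₂ = u , ≤-antisym (d-minimal w₁) t≤au , ≤-antisym (d-minimal w₂) D-t≤ub
    where
    D≤au+ub : d a b ≤ d a u + d u b
    D≤au+ub = d-triangle a u b
    t≤au : t ≤ d a u
    t≤au = +-cancelʳ-≤ (d a b ∸ t) t (d a u)
             (subst (_≤ d a u + (d a b ∸ t)) (sym (m+[n∸m]≡n t≤D))
               (≤-trans D≤au+ub (+-monoʳ-≤ (d a u) (d-minimal w₂))))
    D-t≤ub : d a b ∸ t ≤ d u b
    D-t≤ub = m≤n+o⇒m∸n≤o (d a b) t (≤-trans D≤au+ub (+-monoˡ-≤ (d u b) (d-minimal w₁)))

  ≡d⇒SameRep : ∀ {W p q} → (∀ w → w ∈ W → d p w ≡ d q w) → SameRep G W p q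
  ≡d⇒SameRep {p = p} {q} agree w w∈W m =
    (λ D → subst (Dist G q w) (sym (trans (Dist⇒≡d D) (agree w w∈W))) (d-Dist q w)) ,
    (λ D → subst (Dist G p w) (sym (trans (Dist⇒≡d D) (sym (agree w w∈W)))) (d-Dist p w))

  SameRep⇒≡d : ∀ {W p q w} → SameRep G W p q → w ∈ W → d p w ≡ d q w
  SameRep⇒≡d {p = p} {w = w} same w∈W = Dist⇒≡d (proj₁ (same w w∈W (d p w)) (d-Dist p w))

module Separation {n : ℕ} {G : Graph n} (connected : Connected G) (v : Fin n) where
  open Walks G
  open Distance connected

  Joined : Fin n → Fin n → Set
  Joined a b = ∃ λ ℓ → WalkIn G (_≢ v) a b ℓ

  Joined-sym : ∀ {a b} → Joined a b → Joined b a
  Joined-sym (_ , w) = _ , reverse w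

  Joined-trans : ∀ {a b c} → Joined a b → Joined b c → Joined a c
  Joined-trans (_ , w) (_ , w′) = _ , w ++ w′

  Joined⇒≢cut : ∀ {a b} → Joined a b → a ≢ v
  Joined⇒≢cut (_ , w) = source w

  d-through-cut : ∀ {p w} → ¬ Joined p w → d p w ≡ d p v + d v w
  d-through-cut {p} {w} p≁w with avoids-or-visits v (d-walk p w)
  ... | inj₁ avoiding               = contradiction (_ , avoiding) p≁w
  ... | inj₂ (a , b , w₁ , w₂ , eq) = ≤-antisym (d-triangle p v w)
          (subst (d p v + d v w ≤_) eq (+-mono-≤ (d-minimal w₁) (d-minimal w₂)))

  determined-by-d-cut : ∀ {z} → Resolving G (⁅ v ⁆ ∪ ⁅ z ⁆) → ∀ {p q} →
                        ¬ Joined p z → ¬ Joined q z → d p v ≡ d q v → p ≡ q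
  determined-by-d-cut {z} resolving {p} {q} p≁z q≁z pv≡qv = resolving p q (≡d⇒SameRep agree)
    where
    agree : ∀ w → w ∈ ⁅ v ⁆ ∪ ⁅ z ⁆ → d p w ≡ d q w
    agree w w∈vz with x∈p∪q⁻ ⁅ v ⁆ ⁅ z ⁆ w∈vz
    ... | inj₁ w∈v rewrite x∈⁅y⁆⇒x≡y v w∈v = pv≡qv
    ... | inj₂ w∈z rewrite x∈⁅y⁆⇒x≡y z w∈z = begin
      d p z         ≡⟨ d-through-cut p≁z ⟩
      d p v + d v z ≡⟨ cong (_+ d v z) pv≡qv ⟩
      d q v + d v z ≡⟨ d-through-cut q≁z ⟨
      d q z         ∎
      where open ≡-Reasoning

  module _ {x y} (x≁y : ¬ Joined x y) where

    off-x-or-off-y : ∀ {p} → Dec (Joined p x) → ¬ Joined p x ⊎ ¬ Joined p y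
    off-x-or-off-y (yes p~x) = inj₂ λ p~y → x≁y (Joined-trans (Joined-sym p~x) p~y)
    off-x-or-off-y (no p≁x)  = inj₁ p≁x

    d-cut≡⊔ : ∀ p → ¬ Joined p x ⊎ ¬ Joined p y → d p v ≡ (d p x ∸ d v x) ⊔ (d p y ∸ d v y)
    d-cut≡⊔ p off = ≤-antisym (reached off) (⊔-lub (bound x) (bound y))
      where
      bound : ∀ z → d p z ∸ d v z ≤ d p v
      bound z = m≤n+o⇒m∸n≤o (d p z) (d v z) (subst (d p z ≤_) (+-comm (d p v) (d v z)) (d-triangle p v z))
      exact : ∀ {z} → ¬ Joined p z → d p z ∸ d v z ≡ d p v
      exact {z} p≁z = trans (cong (_∸ d v z) (d-through-cut p≁z)) (m+n∸n≡m (d p v) (d v z))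
      reached : ¬ Joined p x ⊎ ¬ Joined p y → d p v ≤ (d p x ∸ d v x) ⊔ (d p y ∸ d v y)
      reached (inj₁ p≁x) = m≤n⇒m≤n⊔o _ (≤-reflexive (sym (exact p≁x)))
      reached (inj₂ p≁y) = m≤n⇒m≤o⊔n _ (≤-reflexive (sym (exact p≁y)))

    resolving-without-cut : (∀ p → Dec (Joined p x)) → ∀ {W} → x ∈ W - v → y ∈ W - v →
                            Resolving G W → Resolving G (W - v)
    resolving-without-cut x? {W} x∈S y∈S resolving p q same = resolving p q (≡d⇒SameRep agree)
      where
      open ≡-Reasoning
      agree : ∀ w → w ∈ W → d p w ≡ d q w
      agree w w∈W with w ≟ v
      ... | no w≢v = SameRep⇒≡d same (x∈p∧x≢y⇒x∈p-y w∈W w≢v)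
      ... | yes refl = begin
        d p v                               ≡⟨ d-cut≡⊔ p (off-x-or-off-y (x? p)) ⟩
        (d p x ∸ d v x) ⊔ (d p y ∸ d v y)  ≡⟨ cong₂ (λ a b → (a ∸ d v x) ⊔ (b ∸ d v y))
                                                   (SameRep⇒≡d same x∈S) (SameRep⇒≡d same y∈S) ⟩
        (d q x ∸ d v x) ⊔ (d q y ∸ d v y)  ≡⟨ d-cut≡⊔ q (off-x-or-off-y (x? q)) ⟨
        d q v                               ∎

    module Farthest (x≢v : x ≢ v) (y≢v : y ≢ v) (y? : ∀ p → Dec (Joined p y))
                    (pair-resolving : ∀ z → z ≢ v → Resolving G (⁅ v ⁆ ∪ ⁅ z ⁆))
                    {e : Fin n} (e-off : ¬ Joined e y) (e-farthest : ∀ p → ¬ Joined p y → d v p ≤ d v e) where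

      D : ℕ
      D = d v e

      e≢v : e ≢ v
      e≢v e≡v = <⇒≱ (≢⇒0<d (x≢v ∘ sym))
                     (subst (d v x ≤_) (trans (cong (d v) e≡v) (d-refl v)) (e-farthest x x≁y))

      on⇒≁e : ∀ {p} → Joined p y → ¬ Joined p e
      on⇒≁e p~y p~e = e-off (Joined-trans (Joined-sym p~e) p~y)

      on⇒through-cut : ∀ {p} → Joined p y → d p e ≡ d p v + D
      on⇒through-cut p~y = d-through-cut (on⇒≁e p~y)

      -- The vertex u at distance d v p from v on a geodesic from v to e is itself off y's side
      -- (else d u e = d u v + D), so it has the same distance to v as p and must be p.
      off⇒on-geodesic : ∀ {p} → ¬ Joined p y → d p e ≡ D ∸ d v p
      off⇒on-geodesic {p} p-off = ≤-antisym upper (m≤n+o⇒m∸n≤o D (d v p) (d-triangle v p e))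
        where
        t = d v p
        split = geodesic-split v e t (e-farthest p p-off)
        u = proj₁ split
        vu≡t : d v u ≡ t
        vu≡t = proj₁ (proj₂ split)
        ue≡D-t : d u e ≡ D ∸ t
        ue≡D-t = proj₂ (proj₂ split)
        u-off : ¬ Joined u y
        u-off u~y = Joined⇒≢cut u~y (d≡0⇒≡ uv≡0)
          where
          uv+D≤D : d u v + D ≤ D
          uv+D≤D = subst (_≤ D) (trans (sym ue≡D-t) (on⇒through-cut u~y)) (m∸n≤m D t)
          uv≡0 : d u v ≡ 0
          uv≡0 = n≤0⇒n≡0 (+-cancelʳ-≤ D (d u v) 0 uv+D≤D)
        u≡p : u ≡ p
        u≡p = determined-by-d-cut (pair-resolving y y≢v) u-off p-off
                (trans (d-sym u v) (trans vu≡t (d-sym v p)))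
        upper : d p e ≤ D ∸ t
        upper = subst (λ w → d w e ≤ D ∸ t) u≡p (≤-reflexive ue≡D-t)

      off⇒≤D : ∀ {p} → ¬ Joined p y → d p e ≤ D
      off⇒≤D {p} p-off = subst (_≤ D) (sym (off⇒on-geodesic p-off)) (m∸n≤m D (d v p))

      on⇒>D : ∀ {p} → Joined p y → D < d p e
      on⇒>D {p} p~y = subst (D <_) (sym (on⇒through-cut p~y))
                        (m<n+m D (≢⇒0<d (Joined⇒≢cut p~y)))

      e-resolving : Resolving G ⁅ e ⁆
      e-resolving p q same with SameRep⇒≡d same (x∈⁅x⁆ e) | y? p | y? q
      ... | pe≡qe | no p-off | no q-off = determined-by-d-cut (pair-resolving y y≢v) p-off q-off
            (trans (d-sym p v) (trans vp≡vq (d-sym v q)))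
        where
        vp≡vq : d v p ≡ d v q
        vp≡vq = ∸-cancelˡ-≡ (e-farthest p p-off) (e-farthest q q-off)
                  (trans (sym (off⇒on-geodesic p-off)) (trans pe≡qe (off⇒on-geodesic q-off)))
      ... | pe≡qe | yes p~y | yes q~y = determined-by-d-cut (pair-resolving e e≢v) (on⇒≁e p~y) (on⇒≁e q~y)
            (+-cancelʳ-≡ D (d p v) (d q v)
              (trans (sym (on⇒through-cut p~y)) (trans pe≡qe (on⇒through-cut q~y))))
      ... | pe≡qe | no p-off | yes q~y = contradiction (subst (_≤ D) pe≡qe (off⇒≤D p-off)) (<⇒≱ (on⇒>D q~y))
      ... | pe≡qe | yes p~y | no q-off = contradiction (subst (_≤ D) (sym pe≡qe) (off⇒≤D q-off)) (<⇒≱ (on⇒>D p~y))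

    ∃-resolving-singleton : x ≢ v → y ≢ v → (∀ p → Dec (Joined p y)) →
                            (∀ z → z ≢ v → Resolving G (⁅ v ⁆ ∪ ⁅ z ⁆)) → ∃ λ e → Resolving G ⁅ e ⁆
    ∃-resolving-singleton x≢v y≢v y? pair-resolving with maximise (¬? ∘ y?) (d v) x≁y
    ... | e , e-off , e-farthest = e , Farthest.e-resolving x≢v y≢v y? pair-resolving e-off e-farthest

-- Reachability in G − v is not decidable here, but since the goal is ⊥ we may assume
-- (via ¬¬-∀-Fin) that it is decided for all vertices at once.
mainTheorem4 : (n : ℕ) (G : Graph n) (k : ℕ) → Connected G → 2 ≤ k →
    RandomlyDimensional G k → ∀ (v : Fin n) → ¬ CutVertex G v
mainTheorem4 n G k connected 2≤k (((W₀ , ∣W₀∣≡k , _) , minimal) , random) v (x , y , x≢v , y≢v , x≁y′) =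
  [ 3≤k-impossible , 2≡k-impossible ]′ (m≤n⇒m<n∨m≡n 2≤k)
  where
  open Separation connected v

  x≁y : ¬ Joined x y
  x≁y (ℓ , w) = x≁y′ ℓ w

  2≡k-impossible : 2 ≡ k → ⊥
  2≡k-impossible 2≡k = ¬¬-∀-Fin (λ _ → ¬¬-excluded-middle) λ y? →
    let (e , e-resolving) = ∃-resolving-singleton x≁y x≢v y≢v y?
                              (λ z z≢v → random _ (trans (∣⁅x⁆∪⁅y⁆∣≡2 (z≢v ∘ sym)) 2≡k))
    in <⇒≱ 2≤k (subst (k ≤_) (∣⁅x⁆∣≡1 e) (minimal ⁅ e ⁆ e-resolving))

  3≤k-impossible : 3 ≤ k → ⊥
  3≤k-impossible 3≤k = ¬¬-∀-Fin (λ _ → ¬¬-excluded-middle) λ x? →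
    let (W , v∈W , x∈W , y∈W , ∣W∣≡k) = ∃-superset-of-three v x y 3≤k (subst (_≤ n) ∣W₀∣≡k (∣p∣≤n W₀))
        W-v-resolving = resolving-without-cut x≁y x? (x∈p∧x≢y⇒x∈p-y x∈W x≢v) (x∈p∧x≢y⇒x∈p-y y∈W y≢v)
                          (random W ∣W∣≡k)
    in <⇒≱ (subst (∣ W - v ∣ <_) ∣W∣≡k (x∈p⇒∣p-x∣<∣p∣ v∈W)) (minimal (W - v) W-v-resolving)
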